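{- Let $\pi=\pi(1)\cdots\pi(n)\in S_n$ and let $\mathrm{rot}(\pi)=\pi(n)\pi(1)\cdots\pi(n-1)$ be its cyclic shift to the right. Then \[ \mathrm{cocharge}(\pi)=\begin{cases}\mathrm{cocharge}(\mathrm{rot}(\pi))-1 & \text{if }\pi(n)\ne1,\\ \mathrm{cocharge}(\mathrm{rot}(\pi))+n-1 & \text{if }\pi(n)=1.\end{cases} \] In particular $\mathrm{cocharge}(\pi)\equiv\mathrm{cocharge}(\mathrm{rot}(\pi))-1\pmod n$.
   Context: For $\pi\in S_n$ in one-line notation, define cocharge values $cc(\pi,1)=0$ and, for $2\le j\le n$, $cc(\pi,j)=cc(\pi,j-1)$ if $j-1$ appears to the left of $j$ in $\pi$, and $cc(\pi,j)=cc(\pi,j-1)+1$ otherwise. Then $\mathrm{cocharge}(\pi)=\sum_{j=1}^n cc(\pi,j)$ (equivalently $\binom n2-\mathrm{maj}(\mathrm{rev}(\pi^{ -1}))$). -}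

module Defs where

open import Data.Nat using (ℕ; zero; suc; _+_; _<_)
open import Data.Fin using (Fin; zero; suc; toℕ; fromℕ; inject₁)
open import Data.Fin.Permutation using (Permutation′; permutation; _⟨$⟩ʳ_; _⟨$⟩ˡ_; _∘ₚ_)
open import Relation.Binary.PropositionalEquality using (_≡_; refl; cong)
open import Relation.Nullary using (yes; no)
open import Data.Nat using (_<?_)

-- Permutations of {1,…,n} are represented as Permutation′ n on Fin n,
-- with value k : Fin n standing for k+1 and position i : Fin n for i+1.
-- The one-line word of π is i ↦ π ⟨$⟩ʳ i; π ⟨$⟩ˡ v is the position of v.

shift : ∀ {m} → Fin (suc m) → Fin (suc m)
shift {m} zero = fromℕ m
shift (suc i) = inject₁ i

unshift : ∀ {m} → Fin (suc m) → Fin (suc m)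
unshift {zero} zero = zero
unshift {suc m} zero = suc zero
unshift {suc m} (suc j) with unshift {m} j
... | zero = zero
... | suc k = suc (suc k)

private
  unshift-last : ∀ m → unshift (fromℕ m) ≡ zero
  unshift-last zero = refl
  unshift-last (suc m) rewrite unshift-last m = refl

  unshift-inj : ∀ {m} (i : Fin m) → unshift (inject₁ i) ≡ suc i
  unshift-inj {suc m} zero = refl
  unshift-inj {suc m} (suc i) rewrite unshift-inj i = refl

  shift-unshift : ∀ {m} (j : Fin (suc m)) → shift (unshift j) ≡ j
  shift-unshift {zero} zero = refl
  shift-unshift {suc m} zero = refl
  shift-unshift {suc m} (suc j) with unshift {m} j | shift-unshift {m} j
  ... | zero | eq = cong suc eq
  ... | suc k | eq = cong suc eq

  unshift-shift : ∀ {m} (i : Fin (suc m)) → unshift (shift i) ≡ i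
  unshift-shift {m} zero = unshift-last m
  unshift-shift (suc i) = unshift-inj i

shiftPerm : ∀ {m} → Permutation′ (suc m)
shiftPerm = permutation shift unshift shift-unshift unshift-shift

-- rot(π) = π(n) π(1) ⋯ π(n-1):  rot π ⟨$⟩ʳ i = π ⟨$⟩ʳ (shift i)
rot : ∀ {m} → Permutation′ (suc m) → Permutation′ (suc m)
rot π = shiftPerm ∘ₚ π

-- descent indicator: for k+1 : Fin n (value j = k+2), it is 1 iff j-1 does
-- NOT appear to the left of j in π, i.e. not (pos(j-1) < pos(j))
incr : ∀ {n} → Permutation′ n → Fin n → ℕ
incr π zero = 0
incr π (suc k) with toℕ (π ⟨$⟩ˡ inject₁ k) <? toℕ (π ⟨$⟩ˡ suc k)
... | yes _ = 0
... | no  _ = 1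

-- cc(π, j) for j = 1..n, indexed by the 0-based value v : Fin n (v = j-1):
-- cc(π,1) = 0, cc(π,j) = cc(π,j-1) + [j-1 not left of j]
ccAux : ∀ {n} → (Fin n → ℕ) → Fin n → ℕ
ccAux f zero = f zero
ccAux f (suc k) = f zero + ccAux (λ i → f (suc i)) k

cc : ∀ {n} → Permutation′ n → Fin n → ℕ
cc π = ccAux (incr π)

sumFin : ∀ {n} → (Fin n → ℕ) → ℕ
sumFin {zero} f = 0
sumFin {suc n} f = f zero + sumFin (λ i → f (suc i))

cocharge : ∀ {n} → Permutation′ n → ℕ
cocharge π = sumFin (cc π)

module Submission where

-- Write the descent vector of π ∈ S_n (n = m + 1) as
-- d_k = [k+1 does not appear to the left of k+2] for k < m, so that
-- cocharge π = Σ_j Σ_{k<j} d_k is the "weight" of d, a sum of prefix sums;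
-- the weight is additive and the indicator of index a weighs (length - a).
-- Rotating π moves the last entry x = π(n) to the front and every other
-- entry one place to the right, so it changes only the two descent bits
-- involving x: the pair (x-1, x) gains a descent and the pair (x, x+1) loses
-- one.  As a pointwise identity of descent vectors,
--   d(rot π)_k + [k = x] = d(π)_k + [k + 1 = x],
-- and taking weights gives cocharge(rot π) + (m - x) = cocharge π + W, where
-- W = 0 if x = 0 and W = m - x + 1 otherwise.

open import Defs
open import Data.Nat using (ℕ; suc; _+_; _%_)
open import Data.Fin using (zero; fromℕ)
open import Data.Fin.Permutation using (Permutation′; _⟨$⟩ʳ_)
open import Data.Product using (_×_)
open import Relation.Binary.PropositionalEquality using (_≡_; _≢_)

open import Data.Nat using (zero; _<_; _<?_; z<s; s<s; s<s⁻¹)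
open import Data.Nat.Properties
  using (+-suc; +-assoc; +-comm; +-identityʳ; +-cancelʳ-≡; <-irrefl; <-asym; +-commutativeSemigroup)
open import Algebra.Properties.CommutativeSemigroup +-commutativeSemigroup
  renaming (interchange to +-interchange)
open import Data.Nat.DivMod using ([m+n]%n≡m%n)
open import Data.Fin using (Fin; toℕ; inject₁; _≟_; suc)
open import Data.Fin.Properties using (toℕ-fromℕ; toℕ-inject₁; toℕ<n; fromℕ≢inject₁)
open import Data.Fin.Permutation using (_⟨$⟩ˡ_; inverseˡ; inverseʳ)
open import Data.Product using (_,_)
open import Data.Empty using (⊥-elim)
open import Relation.Binary.PropositionalEquality using (refl; sym; trans; cong; cong₂; module ≡-Reasoning)
open import Relation.Nullary using (yes; no; ¬_)

open ≡-Reasoning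

weight : ∀ {n} → (Fin n → ℕ) → ℕ
weight f = sumFin (ccAux f)

ccAux-cong : ∀ {n} {f g : Fin n → ℕ} → (∀ i → f i ≡ g i) → ∀ k → ccAux f k ≡ ccAux g k
ccAux-cong f≗g zero = f≗g zero
ccAux-cong f≗g (suc k) = cong₂ _+_ (f≗g zero) (ccAux-cong (λ i → f≗g (suc i)) k)

sumFin-cong : ∀ {n} {f g : Fin n → ℕ} → (∀ i → f i ≡ g i) → sumFin f ≡ sumFin g
sumFin-cong {zero} f≗g = refl
sumFin-cong {suc n} f≗g = cong₂ _+_ (f≗g zero) (sumFin-cong (λ i → f≗g (suc i)))

weight-cong : ∀ {n} {f g : Fin n → ℕ} → (∀ i → f i ≡ g i) → weight f ≡ weight g
weight-cong f≗g = sumFin-cong (ccAux-cong f≗g)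

ccAux-+ : ∀ {n} (f g : Fin n → ℕ) k → ccAux (λ i → f i + g i) k ≡ ccAux f k + ccAux g k
ccAux-+ f g zero = refl
ccAux-+ f g (suc k) = trans (cong (f zero + g zero +_) (ccAux-+ (λ i → f (suc i)) (λ i → g (suc i)) k))
                           (+-interchange (f zero) (g zero) _ _)

sumFin-+ : ∀ {n} (f g : Fin n → ℕ) → sumFin (λ i → f i + g i) ≡ sumFin f + sumFin g
sumFin-+ {zero} f g = refl
sumFin-+ {suc n} f g = trans (cong (f zero + g zero +_) (sumFin-+ (λ i → f (suc i)) (λ i → g (suc i))))
                             (+-interchange (f zero) (g zero) _ _)

weight-+ : ∀ {n} (f g : Fin n → ℕ) → weight (λ i → f i + g i) ≡ weight f + weight g
weight-+ f g = trans (sumFin-cong (ccAux-+ f g)) (sumFin-+ (ccAux f) (ccAux g))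

ccAux-zero : ∀ {n} (k : Fin n) → ccAux (λ _ → 0) k ≡ 0
ccAux-zero zero = refl
ccAux-zero (suc k) = ccAux-zero k

-- The prefix sums of the indicator of the first index are all 1.
sumFin-one : ∀ n → sumFin {n} (λ i → suc (ccAux (λ _ → 0) i)) ≡ n
sumFin-one zero = refl
sumFin-one (suc n) = cong₂ _+_ refl (sumFin-one n)

sumFin-zero : ∀ n → sumFin {n} (λ _ → 0) ≡ 0
sumFin-zero zero = refl
sumFin-zero (suc n) = sumFin-zero n

weight-zero : ∀ n → weight {n} (λ _ → 0) ≡ 0
weight-zero n = trans (sumFin-cong {n} {g = λ _ → 0} ccAux-zero) (sumFin-zero n)

δ : ∀ {n} → Fin n → Fin n → ℕ
δ zero zero = 1
δ zero (suc _) = 0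
δ (suc a) zero = 0
δ (suc a) (suc b) = δ a b

δ-refl : ∀ {n} (a : Fin n) → δ a a ≡ 1
δ-refl zero = refl
δ-refl (suc a) = δ-refl a

δ-≢ : ∀ {n} {a b : Fin n} → a ≢ b → δ a b ≡ 0
δ-≢ {a = zero} {zero} a≢b = ⊥-elim (a≢b refl)
δ-≢ {a = zero} {suc b} a≢b = refl
δ-≢ {a = suc a} {zero} a≢b = refl
δ-≢ {a = suc a} {suc b} a≢b = δ-≢ (λ a≡b → a≢b (cong suc a≡b))

δ-injective : ∀ {n} (σ : Fin n → Fin n) → (∀ {a b} → σ a ≡ σ b → a ≡ b) →
              ∀ a b → δ (σ a) (σ b) ≡ δ a b
δ-injective σ σ-inj a b with a ≟ b
... | yes refl = trans (δ-refl (σ a)) (sym (δ-refl a))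
... | no a≢b = trans (δ-≢ (λ e → a≢b (σ-inj e))) (sym (δ-≢ a≢b))

weight-δ : ∀ {n} (a : Fin n) → weight (δ a) + toℕ a ≡ n
weight-δ {suc n} zero = trans (+-identityʳ _) (cong suc (sumFin-one n))
weight-δ {suc n} (suc a) = trans (+-suc _ (toℕ a)) (cong suc (weight-δ a))

weight-δ-inject₁ : ∀ {m} (a : Fin (suc m)) → weight {m} (λ k → δ a (inject₁ k)) + toℕ a ≡ m
weight-δ-inject₁ {zero} zero = refl
weight-δ-inject₁ {suc m} zero = trans (cong (_+ 0) (weight-cong δ-zero-inject₁)) (weight-δ zero)
  where
  δ-zero-inject₁ : ∀ (k : Fin (suc m)) → δ zero (inject₁ k) ≡ δ zero k
  δ-zero-inject₁ zero = refl
  δ-zero-inject₁ (suc k) = refl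
weight-δ-inject₁ {suc m} (suc a) = trans (+-suc _ (toℕ a)) (cong suc (weight-δ-inject₁ a))

notLess : ℕ → ℕ → ℕ
notLess a b with a <? b
... | yes _ = 0
... | no _ = 1

notLess-< : ∀ {a b} → a < b → notLess a b ≡ 0
notLess-< {a} {b} a<b with a <? b
... | yes _ = refl
... | no a≮b = ⊥-elim (a≮b a<b)

notLess-≮ : ∀ {a b} → ¬ a < b → notLess a b ≡ 1
notLess-≮ {a} {b} a≮b with a <? b
... | yes a<b = ⊥-elim (a≮b a<b)
... | no _ = refl

notLess-suc : ∀ a b → notLess (suc a) (suc b) ≡ notLess a b
notLess-suc a b with a <? b
... | yes a<b = notLess-< (s<s a<b)
... | no a≮b = notLess-≮ (λ sa<sb → a≮b (s<s⁻¹ sa<sb))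

data LastOrInner {m : ℕ} : Fin (suc m) → Set where
  last  : LastOrInner (fromℕ m)
  inner : (j : Fin m) → LastOrInner (inject₁ j)

lastOrInner : ∀ {m} (p : Fin (suc m)) → LastOrInner p
lastOrInner {zero} zero = last
lastOrInner {suc m} zero = inner zero
lastOrInner {suc m} (suc p) with lastOrInner p
... | last = last
... | inner j = inner (suc j)

unshift-last : ∀ m → unshift (fromℕ m) ≡ zero
unshift-last zero = refl
unshift-last (suc m) rewrite unshift-last m = refl

unshift-inject₁ : ∀ {m} (j : Fin m) → unshift (inject₁ j) ≡ suc j
unshift-inject₁ {suc m} zero = refl
unshift-inject₁ {suc m} (suc j) rewrite unshift-inject₁ j = refl

δ-last-inject₁ : ∀ {m} (j : Fin m) → δ (fromℕ m) (inject₁ j) ≡ 0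
δ-last-inject₁ j = δ-≢ (fromℕ≢inject₁ {i = j})

-- Effect of the shift on the order of two positions p, q: the comparison bit
-- changes exactly when one of them is the last position, and the change is
-- compensated by the indicators of the last position.
notLess-unshift : ∀ {m} (p q : Fin (suc m)) →
  notLess (toℕ (unshift p)) (toℕ (unshift q)) + δ (fromℕ m) p
    ≡ notLess (toℕ p) (toℕ q) + δ (fromℕ m) q
notLess-unshift {m} p q with lastOrInner p | lastOrInner q
... | last | last = cong (_+ δ (fromℕ m) (fromℕ m))
  (trans (notLess-≮ (<-irrefl refl)) (sym (notLess-≮ (<-irrefl refl))))
... | last | inner j = begin
  notLess (toℕ (unshift (fromℕ m))) (toℕ (unshift (inject₁ j))) + δ (fromℕ m) (fromℕ m)
    ≡⟨ cong₂ _+_ (cong₂ notLess (cong toℕ (unshift-last m)) (cong toℕ (unshift-inject₁ j)))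
                 (δ-refl (fromℕ m)) ⟩
  notLess 0 (suc (toℕ j)) + 1
    ≡⟨ cong (_+ 1) (notLess-< {0} {suc (toℕ j)} z<s) ⟩
  1
    ≡⟨ cong (_+ 0) (sym (notLess-≮ (<-asym (toℕ<n j)))) ⟩
  notLess m (toℕ j) + 0
    ≡⟨ sym (cong₂ _+_ (cong₂ notLess (toℕ-fromℕ m) (toℕ-inject₁ j)) (δ-last-inject₁ j)) ⟩
  notLess (toℕ (fromℕ m)) (toℕ (inject₁ j)) + δ (fromℕ m) (inject₁ j)  ∎
... | inner i | last = begin
  notLess (toℕ (unshift (inject₁ i))) (toℕ (unshift (fromℕ m))) + δ (fromℕ m) (inject₁ i)
    ≡⟨ cong₂ _+_ (cong₂ notLess (cong toℕ (unshift-inject₁ i)) (cong toℕ (unshift-last m)))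
                 (δ-last-inject₁ i) ⟩
  notLess (suc (toℕ i)) 0 + 0
    ≡⟨ cong (_+ 0) (notLess-≮ {suc (toℕ i)} {0} (λ ())) ⟩
  1
    ≡⟨ cong (_+ 1) (sym (notLess-< (toℕ<n i))) ⟩
  notLess (toℕ i) m + 1
    ≡⟨ sym (cong₂ _+_ (cong₂ notLess (toℕ-inject₁ i) (toℕ-fromℕ m)) (δ-refl (fromℕ m))) ⟩
  notLess (toℕ (inject₁ i)) (toℕ (fromℕ m)) + δ (fromℕ m) (fromℕ m)  ∎
... | inner i | inner j = begin
  notLess (toℕ (unshift (inject₁ i))) (toℕ (unshift (inject₁ j))) + δ (fromℕ m) (inject₁ i)
    ≡⟨ cong₂ _+_ (cong₂ notLess (cong toℕ (unshift-inject₁ i)) (cong toℕ (unshift-inject₁ j)))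
                 (δ-last-inject₁ i) ⟩
  notLess (suc (toℕ i)) (suc (toℕ j)) + 0
    ≡⟨ cong (_+ 0) (notLess-suc (toℕ i) (toℕ j)) ⟩
  notLess (toℕ i) (toℕ j) + 0
    ≡⟨ sym (cong₂ _+_ (cong₂ notLess (toℕ-inject₁ i) (toℕ-inject₁ j)) (δ-last-inject₁ j)) ⟩
  notLess (toℕ (inject₁ i)) (toℕ (inject₁ j)) + δ (fromℕ m) (inject₁ j)  ∎

descents : ∀ {m} → Permutation′ (suc m) → Fin m → ℕ
descents σ k = incr σ (suc k)

descents-notLess : ∀ {m} (σ : Permutation′ (suc m)) k →
  descents σ k ≡ notLess (toℕ (σ ⟨$⟩ˡ inject₁ k)) (toℕ (σ ⟨$⟩ˡ suc k))
descents-notLess σ k with toℕ (σ ⟨$⟩ˡ inject₁ k) <? toℕ (σ ⟨$⟩ˡ suc k)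
... | yes _ = refl
... | no _ = refl

-- The value 1 never contributes a descent bit, so the cocharge is exactly
-- the weight of the descent vector.
cocharge-weight : ∀ {m} (σ : Permutation′ (suc m)) → cocharge σ ≡ weight (descents σ)
cocharge-weight σ = refl

module _ {m : ℕ} (π : Permutation′ (suc m)) where

  lastEntry : Fin (suc m)
  lastEntry = π ⟨$⟩ʳ fromℕ m

  position-injective : ∀ {a b} → π ⟨$⟩ˡ a ≡ π ⟨$⟩ˡ b → a ≡ b
  position-injective {a} {b} e =
    trans (sym (inverseʳ π)) (trans (cong (π ⟨$⟩ʳ_) e) (inverseʳ π))

  δ-last-position : ∀ v → δ (fromℕ m) (π ⟨$⟩ˡ v) ≡ δ lastEntry v
  δ-last-position v = begin
    δ (fromℕ m) (π ⟨$⟩ˡ v)             ≡⟨ cong (λ p → δ p (π ⟨$⟩ˡ v)) (sym (inverseˡ π)) ⟩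
    δ (π ⟨$⟩ˡ lastEntry) (π ⟨$⟩ˡ v)    ≡⟨ δ-injective (π ⟨$⟩ˡ_) position-injective lastEntry v ⟩
    δ lastEntry v                       ∎

  -- Rotation gains a descent at the pair (x-1, x) and loses one at (x, x+1).
  -- The position of v in rot π is, by definition, unshift of its position in π.
  descents-rot : ∀ k → descents (rot π) k + δ lastEntry (inject₁ k)
                       ≡ descents π k + δ lastEntry (suc k)
  descents-rot k = begin
    descents (rot π) k + δ lastEntry (inject₁ k)
      ≡⟨ cong₂ _+_ (descents-notLess (rot π) k) (sym (δ-last-position (inject₁ k))) ⟩
    notLess (toℕ (unshift (π ⟨$⟩ˡ inject₁ k))) (toℕ (unshift (π ⟨$⟩ˡ suc k)))
      + δ (fromℕ m) (π ⟨$⟩ˡ inject₁ k)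
      ≡⟨ notLess-unshift (π ⟨$⟩ˡ inject₁ k) (π ⟨$⟩ˡ suc k) ⟩
    notLess (toℕ (π ⟨$⟩ˡ inject₁ k)) (toℕ (π ⟨$⟩ˡ suc k)) + δ (fromℕ m) (π ⟨$⟩ˡ suc k)
      ≡⟨ cong₂ _+_ (sym (descents-notLess π k)) (δ-last-position (suc k)) ⟩
    descents π k + δ lastEntry (suc k)  ∎

  lostWeight gainedWeight : ℕ
  lostWeight = weight (λ k → δ lastEntry (inject₁ k))
  gainedWeight = weight (λ k → δ lastEntry (suc k))

  cocharge-rot : cocharge (rot π) + lostWeight ≡ cocharge π + gainedWeight
  cocharge-rot = begin
    cocharge (rot π) + lostWeight
      ≡⟨ cong (_+ lostWeight) (cocharge-weight (rot π)) ⟩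
    weight (descents (rot π)) + lostWeight
      ≡⟨ sym (weight-+ (descents (rot π)) _) ⟩
    weight (λ k → descents (rot π) k + δ lastEntry (inject₁ k))
      ≡⟨ weight-cong descents-rot ⟩
    weight (λ k → descents π k + δ lastEntry (suc k))
      ≡⟨ weight-+ (descents π) _ ⟩
    weight (descents π) + gainedWeight
      ≡⟨ cong (_+ gainedWeight) (sym (cocharge-weight π)) ⟩
    cocharge π + gainedWeight  ∎

  lostWeight-value : lostWeight + toℕ lastEntry ≡ m
  lostWeight-value = weight-δ-inject₁ lastEntry

  cocharge-rot-first : lastEntry ≡ zero → cocharge π ≡ cocharge (rot π) + m
  cocharge-rot-first x≡0 = sym (begin
    cocharge (rot π) + m           ≡⟨ cong (cocharge (rot π) +_) (sym lost≡m) ⟩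
    cocharge (rot π) + lostWeight  ≡⟨ cocharge-rot ⟩
    cocharge π + gainedWeight      ≡⟨ cong (cocharge π +_) gained≡0 ⟩
    cocharge π + 0                 ≡⟨ +-identityʳ _ ⟩
    cocharge π                     ∎)
    where
    lost≡m : lostWeight ≡ m
    lost≡m = trans (sym (+-identityʳ _))
                   (trans (cong (λ x → lostWeight + toℕ x) (sym x≡0)) lostWeight-value)
    gained≡0 : gainedWeight ≡ 0
    gained≡0 = trans (weight-cong (λ k → cong (λ x → δ x (suc k)) x≡0)) (weight-zero m)

  -- Case π(n) = j + 2: the gained descent weighs m - j, one more than the lost one.
  cocharge-rot-other : ∀ {j} → lastEntry ≡ suc j → cocharge π + 1 ≡ cocharge (rot π)
  cocharge-rot-other {j} x≡j+1 = +-cancelʳ-≡ lostWeight _ _ (begin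
    cocharge π + 1 + lostWeight    ≡⟨ +-assoc (cocharge π) 1 lostWeight ⟩
    cocharge π + suc lostWeight    ≡⟨ cong (cocharge π +_) (sym gained≡suc-lost) ⟩
    cocharge π + gainedWeight      ≡⟨ sym cocharge-rot ⟩
    cocharge (rot π) + lostWeight  ∎)
    where
    gained≡suc-lost : gainedWeight ≡ suc lostWeight
    gained≡suc-lost = +-cancelʳ-≡ (toℕ j) _ _ (begin
      gainedWeight + toℕ j
        ≡⟨ cong (_+ toℕ j) (weight-cong (λ k → cong (λ x → δ x (suc k)) x≡j+1)) ⟩
      weight (δ j) + toℕ j           ≡⟨ weight-δ j ⟩
      m                              ≡⟨ sym lostWeight-value ⟩
      lostWeight + toℕ lastEntry     ≡⟨ cong (λ x → lostWeight + toℕ x) x≡j+1 ⟩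
      lostWeight + suc (toℕ j)       ≡⟨ +-suc lostWeight (toℕ j) ⟩
      suc lostWeight + toℕ j         ∎)

+-period-mod : ∀ {a b} m → a ≡ b + m → (a + 1) % suc m ≡ b % suc m
+-period-mod {b = b} m refl = begin
  (b + m + 1) % suc m    ≡⟨ cong (_% suc m) (+-assoc b m 1) ⟩
  (b + (m + 1)) % suc m  ≡⟨ cong (λ t → (b + t) % suc m) (+-comm m 1) ⟩
  (b + suc m) % suc m    ≡⟨ [m+n]%n≡m%n b (suc m) ⟩
  b % suc m              ∎

mainTheorem18 : ∀ (m : ℕ) (π : Permutation′ (suc m)) →
    ((π ⟨$⟩ʳ fromℕ m ≢ zero → cocharge π + 1 ≡ cocharge (rot π))
    × (π ⟨$⟩ʳ fromℕ m ≡ zero → cocharge π ≡ cocharge (rot π) + m))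
    × ((cocharge π + 1) % suc m ≡ cocharge (rot π) % suc m)
mainTheorem18 m π with π ⟨$⟩ʳ fromℕ m in x≡
... | zero = ((λ x≢0 → ⊥-elim (x≢0 refl)) , λ _ → first)
           , +-period-mod m first
  where
  first : cocharge π ≡ cocharge (rot π) + m
  first = cocharge-rot-first π x≡
... | suc j = ((λ _ → other) , λ ()) , cong (_% suc m) other
  where
  other : cocharge π + 1 ≡ cocharge (rot π)
  other = cocharge-rot-other π x≡
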